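{- Let $p>2$ be a prime, let $U=\mathbb{Z}_p^{p+1}$ with standard basis $e_1,\dots,e_{p+1}$ and $V=\mathbb{Z}_p^{p+2}$ with standard basis $f_0,f_1,\dots,f_{p+1}$, and let $G=U\oplus V\cong\mathbb{Z}_p^{2p+3}$. Equip $V$ with the bilinear form $\langle \sum_{i=0}^{p+1}\alpha_if_i,\sum_{i=0}^{p+1}\beta_if_i\rangle=\sum_{i=0}^{p+1}\alpha_i\beta_i$. Define, for $i=1,\dots,p+1$, $$A_i=e_i+\{v\in V:\langle v,f_0+f_i\rangle=0\},\qquad B_i=\sum_{j\ne i,\,1\le j\le p+1}e_j+\Big\{v\in V:\Big\langle v,f_i+\sum_{j=0}^{p+1}f_j\Big\rangle=0\Big\},$$ and $$C_0=\sum_{j=1}^{p+1}e_j+\Big\{v\in V:\Big\langle v,\sum_{j=0}^{p+1}f_j\Big\rangle=0\Big\},\qquad C_1=\sum_{j=1}^{p+1}e_j+\Big\{v\in V:\Big\langle v,\sum_{j=0}^{p+1}f_j\Big\rangle=1\Big\}.$$ Let $S=\bigcup_{i=1}^{p+1}(A_i\cup B_i)\cup C_0$ and $T=\bigcup_{i=1}^{p+1}(A_i\cup B_i)\cup C_1$. Then the Cayley graphs $Cay(G,S)$ and $Cay(G,T)$ are isomorphic.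
   Context: For an abelian group $G$ (written additively) and $S\subseteq G$, the Cayley graph $Cay(G,S)$ is the directed graph with vertex set $G$ in which there is an edge from $a$ to $b$ if and only if $b-a\in S$. An isomorphism $Cay(G,S)\to Cay(G,T)$ is a bijection $\phi:G\to G$ such that $b-a\in S$ if and only if $\phi(b)-\phi(a)\in T$. -}

module Defs where

open import Data.Nat using (ℕ; zero; suc; _+_; _*_; _∸_; NonZero)
open import Data.Nat.DivMod using (_mod_)
open import Data.Fin using (Fin; toℕ; _≟_) renaming (zero to fzero; suc to fsuc)
open import Data.Vec using (Vec; zipWith; replicate; tabulate; foldr′)
open import Data.List using (List; filter; allFin)
import Data.List as L
open import Data.Product using (_×_; _,_; Σ)
open import Data.Sum using (_⊎_)
open import Relation.Nullary using (¬?; yes; no)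
open import Relation.Binary.PropositionalEquality using (_≡_)
open import Function.Bundles using (_⤖_; Bijection; _⇔_)

module Construction (p : ℕ) .{{_ : NonZero p}} where

  Zp : Set
  Zp = Fin p

  0ₚ 1ₚ : Zp
  0ₚ = 0 mod p
  1ₚ = 1 mod p

  _+ₚ_ _-ₚ_ _*ₚ_ : Zp → Zp → Zp
  x +ₚ y = (toℕ x + toℕ y) mod p
  x -ₚ y = (toℕ x + (p ∸ toℕ y)) mod p
  x *ₚ y = (toℕ x * toℕ y) mod p

  -- U = ℤ_p^{p+1}; index j : Fin (p+1) stands for e_{j+1}
  U : Set
  U = Vec Zp (suc p)

  -- V = ℤ_p^{p+2}; index k : Fin (p+2) stands for f_k
  V : Set
  V = Vec Zp (suc (suc p))

  G : Set
  G = U × V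

  _-G_ : G → G → G
  (u , v) -G (u′ , v′) = zipWith _-ₚ_ u u′ , zipWith _-ₚ_ v v′

  _+U_ : U → U → U
  _+U_ = zipWith _+ₚ_

  _+V_ : V → V → V
  _+V_ = zipWith _+ₚ_

  e : Fin (suc p) → U
  e i = tabulate (λ j → case-eq j i)
    where
    case-eq : Fin (suc p) → Fin (suc p) → Zp
    case-eq j i with j ≟ i
    ... | yes _ = 1ₚ
    ... | no _  = 0ₚ

  f : Fin (suc (suc p)) → V
  f k = tabulate (λ j → case-eq j k)
    where
    case-eq : Fin (suc (suc p)) → Fin (suc (suc p)) → Zp
    case-eq j k with j ≟ k
    ... | yes _ = 1ₚ
    ... | no _  = 0ₚ

  sumE : List (Fin (suc p)) → U
  sumE = L.foldr (λ j acc → e j +U acc) (replicate _ 0ₚ)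

  sumF : List (Fin (suc (suc p))) → V
  sumF = L.foldr (λ k acc → f k +V acc) (replicate _ 0ₚ)

  ⟨_,_⟩ : V → V → Zp
  ⟨ v , w ⟩ = foldr′ _+ₚ_ 0ₚ (zipWith _*ₚ_ v w)

  others : Fin (suc p) → List (Fin (suc p))
  others i = filter (λ j → ¬? (j ≟ i)) (allFin (suc p))

  fAll : V
  fAll = sumF (allFin (suc (suc p)))

  eAll : U
  eAll = sumE (allFin (suc p))

  -- A_i, B_i for i = 1..p+1 (i ranges over Fin (p+1), i ↦ i+1), as predicates on G
  A : Fin (suc p) → G → Set
  A i (u , v) = u ≡ e i × ⟨ v , f fzero +V f (fsuc i) ⟩ ≡ 0ₚ

  B : Fin (suc p) → G → Set
  B i (u , v) = u ≡ sumE (others i) × ⟨ v , f (fsuc i) +V fAll ⟩ ≡ 0ₚ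

  C₀ C₁ : G → Set
  C₀ (u , v) = u ≡ eAll × ⟨ v , fAll ⟩ ≡ 0ₚ
  C₁ (u , v) = u ≡ eAll × ⟨ v , fAll ⟩ ≡ 1ₚ

  S T : G → Set
  S x = Σ (Fin (suc p)) (λ i → A i x ⊎ B i x) ⊎ C₀ x
  T x = Σ (Fin (suc p)) (λ i → A i x ⊎ B i x) ⊎ C₁ x

  CayEdge : (G → Set) → G → G → Set
  CayEdge X a b = X (b -G a)

  CayIso : (G → Set) → (G → Set) → Set
  CayIso X Y = Σ (G ⤖ G) λ φ →
    ∀ a b → CayEdge X a b ⇔ CayEdge Y (Bijection.to φ a) (Bijection.to φ b)

module Submission where

-- The isomorphism is φ(u , v) = (u , v + g(u)) for a correction map g : U → V. Whether a
-- difference (d , w) lies in A_i, B_i or C_* depends on w only through the functionals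
-- ⟨_, f₀ + fᵢ⟩, ⟨_, fᵢ + Σf⟩ and ⟨_, Σf⟩, so φ maps S-edges exactly onto T-edges as soon as g
-- shifts these functionals by 0, 0 and 1 along the steps d = eᵢ, Σ_{j≠i} eⱼ and Σⱼ eⱼ.
-- Read the coordinates of u as digits in {0, …, p−1} and put qᵢ(u) = ⌊Σ_{j≠i} uⱼ / p⌋,
-- Q(u) = ⌊Σⱼ uⱼ / p⌋ and Λ(u) = Σᵢ qᵢ(u). With c = Λ + Q, the vector g(u) = c f₀ + Σᵢ (qᵢ − c) fᵢ
-- pairs to qᵢ, qᵢ − Q and Λ with the three functionals. A step eᵢ leaves qᵢ unchanged; adding 1
-- to the p digits j ≠ i raises qᵢ and Q by the same amount, one minus the number of carries;
-- adding 1 to every digit raises Λ by p + 1 − p · (number of carries), which is 1 modulo p.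

open import Algebra.Bundles using (CommutativeRing)
open import Algebra.Consequences.Propositional using (comm∧idˡ⇒id; comm∧invˡ⇒inv; comm∧distrˡ⇒distrʳ)
import Algebra.Properties.CommutativeMonoid.Sum as MonoidSum
open import Data.Bool using (if_then_else_)
open import Data.Fin using (Fin; toℕ; zero; suc; _≟_; punchIn)
open import Data.Fin.Properties using (toℕ-fromℕ<; toℕ-injective; toℕ<n; punchInᵢ≢i)
open import Data.List using (List; []; _∷_; filter; allFin)
import Data.List as List
open import Data.Maybe using (nothing)
open import Data.Nat using (ℕ; suc; _<_; NonZero)
open import Data.Nat.DivMod using (_mod_; m%n<n; m<n⇒m%n≡m; %-distribˡ-+; %-distribˡ-*; [m+kn]%n≡m%n; +-distrib-/-∣ʳ; m*n/n≡m; m≡m%n+[m/n]*n)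
open import Data.Nat.Divisibility using (divides)
open import Data.Nat.Primality using (Prime)
import Data.Nat.Properties as ℕ
open import Data.Nat.Tactic.RingSolver using (solve-∀)
open import Data.Product using (∃; _,_; proj₁)
open import Data.Product.Function.Dependent.Propositional using (Σ-⇔)
open import Data.Sum.Function.Propositional using (_⊎-⇔_)
open import Data.Vec using (Vec; []; _∷_; lookup; tabulate; tail; zipWith; foldr′)
open import Data.Vec.Functional using (removeAt)
open import Data.Vec.Properties using (lookup∘tabulate; lookup-zipWith; lookup-replicate)
open import Defs
open import Function using (_∘_; id; _⇔_; mk⇔; mk↔ₛ′)
open import Function.Construct.Identity using (↠-id)
open import Function.Properties.Inverse using (↔⇒⤖)
open import Level using (0ℓ)
open import Relation.Binary.PropositionalEquality using (_≡_; _≢_; refl; sym; trans; cong; cong₂; module ≡-Reasoning)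
open import Relation.Binary.PropositionalEquality.Properties using (isEquivalence)
open import Relation.Nullary using (yes; no; ¬?; does)
open import Relation.Nullary.Decidable using (dec-false)
import Tactic.RingSolver.Core.AlmostCommutativeRing as AlmostCommutativeRing
import Tactic.RingSolver.NonReflective as RingSolver

module ResidueRing (p : ℕ) .{{_ : NonZero p}} where
  open import Data.Nat using (_+_; _*_; _∸_; _%_)
  open Construction p using (Zp; 0ₚ; 1ₚ; _+ₚ_; _-ₚ_; _*ₚ_)

  [_] : ℕ → Zp
  [ a ] = a mod p

  toℕ-[] : ∀ a → toℕ [ a ] ≡ a % p
  toℕ-[] a = toℕ-fromℕ< (m%n<n a p)

  []-cong : ∀ {a b} → a % p ≡ b % p → [ a ] ≡ [ b ]
  []-cong {a} {b} eq = toℕ-injective (trans (toℕ-[] a) (trans eq (sym (toℕ-[] b))))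

  []-toℕ : ∀ x → [ toℕ x ] ≡ x
  []-toℕ x = toℕ-injective (trans (toℕ-[] (toℕ x)) (m<n⇒m%n≡m (toℕ<n x)))

  []-+ : ∀ a b → [ a + b ] ≡ [ a ] +ₚ [ b ]
  []-+ a b = []-cong (trans (%-distribˡ-+ a b p) (cong₂ (λ x y → (x + y) % p) (sym (toℕ-[] a)) (sym (toℕ-[] b))))

  []-* : ∀ a b → [ a * b ] ≡ [ a ] *ₚ [ b ]
  []-* a b = []-cong (trans (%-distribˡ-* a b p) (cong₂ (λ x y → (x * y) % p) (sym (toℕ-[] a)) (sym (toℕ-[] b))))

  [m+k*p]≡[m] : ∀ m k → [ m + k * p ] ≡ [ m ]
  [m+k*p]≡[m] m k = []-cong ([m+kn]%n≡m%n m k p)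

  [m+p]≡[m] : ∀ m → [ m + p ] ≡ [ m ]
  [m+p]≡[m] m = trans (cong (λ k → [ m + k ]) (sym (ℕ.*-identityˡ p))) ([m+k*p]≡[m] m 1)

  negₚ : Zp → Zp
  negₚ x = [ p ∸ toℕ x ]

  +ₚ-assoc : ∀ x y z → (x +ₚ y) +ₚ z ≡ x +ₚ (y +ₚ z)
  +ₚ-assoc x y z = begin
    [ toℕ x + toℕ y ] +ₚ z             ≡⟨ cong ([ toℕ x + toℕ y ] +ₚ_) ([]-toℕ z) ⟨
    [ toℕ x + toℕ y ] +ₚ [ toℕ z ]     ≡⟨ []-+ (toℕ x + toℕ y) (toℕ z) ⟨
    [ toℕ x + toℕ y + toℕ z ]          ≡⟨ cong [_] (ℕ.+-assoc (toℕ x) (toℕ y) (toℕ z)) ⟩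
    [ toℕ x + (toℕ y + toℕ z) ]        ≡⟨ []-+ (toℕ x) (toℕ y + toℕ z) ⟩
    [ toℕ x ] +ₚ (y +ₚ z)              ≡⟨ cong (_+ₚ (y +ₚ z)) ([]-toℕ x) ⟩
    x +ₚ (y +ₚ z) ∎
    where open ≡-Reasoning

  *ₚ-assoc : ∀ x y z → (x *ₚ y) *ₚ z ≡ x *ₚ (y *ₚ z)
  *ₚ-assoc x y z = begin
    [ toℕ x * toℕ y ] *ₚ z             ≡⟨ cong ([ toℕ x * toℕ y ] *ₚ_) ([]-toℕ z) ⟨
    [ toℕ x * toℕ y ] *ₚ [ toℕ z ]     ≡⟨ []-* (toℕ x * toℕ y) (toℕ z) ⟨
    [ toℕ x * toℕ y * toℕ z ]          ≡⟨ cong [_] (ℕ.*-assoc (toℕ x) (toℕ y) (toℕ z)) ⟩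
    [ toℕ x * (toℕ y * toℕ z) ]        ≡⟨ []-* (toℕ x) (toℕ y * toℕ z) ⟩
    [ toℕ x ] *ₚ (y *ₚ z)              ≡⟨ cong (_*ₚ (y *ₚ z)) ([]-toℕ x) ⟩
    x *ₚ (y *ₚ z) ∎
    where open ≡-Reasoning

  *ₚ-distribˡ-+ₚ : ∀ x y z → x *ₚ (y +ₚ z) ≡ (x *ₚ y) +ₚ (x *ₚ z)
  *ₚ-distribˡ-+ₚ x y z = begin
    x *ₚ [ toℕ y + toℕ z ]             ≡⟨ cong (_*ₚ [ toℕ y + toℕ z ]) ([]-toℕ x) ⟨
    [ toℕ x ] *ₚ [ toℕ y + toℕ z ]     ≡⟨ []-* (toℕ x) (toℕ y + toℕ z) ⟨
    [ toℕ x * (toℕ y + toℕ z) ]        ≡⟨ cong [_] (ℕ.*-distribˡ-+ (toℕ x) (toℕ y) (toℕ z)) ⟩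
    [ toℕ x * toℕ y + toℕ x * toℕ z ]  ≡⟨ []-+ (toℕ x * toℕ y) (toℕ x * toℕ z) ⟩
    (x *ₚ y) +ₚ (x *ₚ z) ∎
    where open ≡-Reasoning

  +ₚ-identityˡ : ∀ x → 0ₚ +ₚ x ≡ x
  +ₚ-identityˡ x = begin
    [ 0 ] +ₚ x         ≡⟨ cong ([ 0 ] +ₚ_) ([]-toℕ x) ⟨
    [ 0 ] +ₚ [ toℕ x ] ≡⟨ []-+ 0 (toℕ x) ⟨
    [ toℕ x ]          ≡⟨ []-toℕ x ⟩
    x ∎
    where open ≡-Reasoning

  *ₚ-identityˡ : ∀ x → 1ₚ *ₚ x ≡ x
  *ₚ-identityˡ x = begin
    [ 1 ] *ₚ x         ≡⟨ cong ([ 1 ] *ₚ_) ([]-toℕ x) ⟨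
    [ 1 ] *ₚ [ toℕ x ] ≡⟨ []-* 1 (toℕ x) ⟨
    [ 1 * toℕ x ]      ≡⟨ cong [_] (ℕ.*-identityˡ (toℕ x)) ⟩
    [ toℕ x ]          ≡⟨ []-toℕ x ⟩
    x ∎
    where open ≡-Reasoning

  negₚ-inverseˡ : ∀ x → negₚ x +ₚ x ≡ 0ₚ
  negₚ-inverseˡ x = begin
    [ p ∸ toℕ x ] +ₚ x           ≡⟨ cong ([ p ∸ toℕ x ] +ₚ_) ([]-toℕ x) ⟨
    [ p ∸ toℕ x ] +ₚ [ toℕ x ]   ≡⟨ []-+ (p ∸ toℕ x) (toℕ x) ⟨
    [ p ∸ toℕ x + toℕ x ]        ≡⟨ cong [_] (ℕ.m∸n+n≡m (ℕ.<⇒≤ (toℕ<n x))) ⟩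
    [ 0 + p ]                    ≡⟨ [m+p]≡[m] 0 ⟩
    0ₚ ∎
    where open ≡-Reasoning

  -ₚ≡+ₚnegₚ : ∀ x y → x -ₚ y ≡ x +ₚ negₚ y
  -ₚ≡+ₚnegₚ x y = begin
    [ toℕ x + (p ∸ toℕ y) ]        ≡⟨ []-+ (toℕ x) (p ∸ toℕ y) ⟩
    [ toℕ x ] +ₚ negₚ y            ≡⟨ cong (_+ₚ negₚ y) ([]-toℕ x) ⟩
    x +ₚ negₚ y ∎
    where open ≡-Reasoning

  ℤₚ : CommutativeRing 0ℓ 0ℓ
  ℤₚ = record
    { Carrier = Zp ; _≈_ = _≡_ ; _+_ = _+ₚ_ ; _*_ = _*ₚ_ ; -_ = negₚ ; 0# = 0ₚ ; 1# = 1ₚ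
    ; isCommutativeRing = record
      { isRing = record
        { +-isAbelianGroup = record
          { isGroup = record
            { isMonoid = record
              { isSemigroup = record { isMagma = record { isEquivalence = isEquivalence ; ∙-cong = cong₂ _+ₚ_ } ; assoc = +ₚ-assoc }
              ; identity = comm∧idˡ⇒id +ₚ-comm +ₚ-identityˡ }
            ; inverse = comm∧invˡ⇒inv +ₚ-comm negₚ-inverseˡ
            ; ⁻¹-cong = cong negₚ }
          ; comm = +ₚ-comm }
        ; *-cong = cong₂ _*ₚ_
        ; *-assoc = *ₚ-assoc
        ; *-identity = comm∧idˡ⇒id *ₚ-comm *ₚ-identityˡ
        ; distrib = *ₚ-distribˡ-+ₚ , comm∧distrˡ⇒distrʳ *ₚ-comm *ₚ-distribˡ-+ₚ }
      ; *-comm = *ₚ-comm } }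
    where
    +ₚ-comm : ∀ x y → x +ₚ y ≡ y +ₚ x
    +ₚ-comm x y = cong [_] (ℕ.+-comm (toℕ x) (toℕ y))
    *ₚ-comm : ∀ x y → x *ₚ y ≡ y *ₚ x
    *ₚ-comm x y = cong [_] (ℕ.*-comm (toℕ x) (toℕ y))

  open CommutativeRing ℤₚ using (zeroˡ; *-identityˡ; distribʳ)
  module ℕΣ = MonoidSum ℕ.+-0-commutativeMonoid
  module ℤₚΣ = MonoidSum (CommutativeRing.+-commutativeMonoid ℤₚ)

  []-sum : ∀ {n} (h : Fin n → ℕ) → [ ℕΣ.sum h ] ≡ ℤₚΣ.sum (λ i → [ h i ])
  []-sum {0} h = refl
  []-sum {suc n} h = trans ([]-+ (h zero) (ℕΣ.sum (h ∘ suc))) (cong ([ h zero ] +ₚ_) ([]-sum (h ∘ suc)))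

  sum-const-ℤₚ : ∀ n x → ℤₚΣ.sum {n} (λ _ → x) ≡ [ n ] *ₚ x
  sum-const-ℤₚ 0 x = sym (zeroˡ x)
  sum-const-ℤₚ (suc n) x = begin
    x +ₚ ℤₚΣ.sum {n} (λ _ → x)   ≡⟨ cong₂ _+ₚ_ (sym (*-identityˡ x)) (sum-const-ℤₚ n x) ⟩
    (1ₚ *ₚ x) +ₚ ([ n ] *ₚ x)    ≡⟨ distribʳ x 1ₚ [ n ] ⟨
    (1ₚ +ₚ [ n ]) *ₚ x           ≡⟨ cong (_*ₚ x) ([]-+ 1 n) ⟨
    [ suc n ] *ₚ x ∎
    where open ≡-Reasoning

  module Solver = RingSolver (AlmostCommutativeRing.fromCommutativeRing ℤₚ (λ _ → nothing))

module UnitVectors (p : ℕ) .{{_ : NonZero p}} where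
  open Construction p
  open ResidueRing p
  open CommutativeRing ℤₚ using (_+_; _*_; 0#; 1#; +-identityˡ; +-identityʳ; *-identityʳ; zeroʳ)
  open ℤₚΣ using (sum; sum-replicate-zero; sum-cong-≗)

  δ : ∀ {n} → Fin n → Fin n → Zp
  δ j k = if does (j ≟ k) then 1# else 0#

  -- δ (suc j) (suc k) reduces to δ j k, since suc j ≟ suc k only relabels j ≟ k; the inductions
  -- over Fin below rely on this.

  δ-≢ : ∀ {n} {j k : Fin n} → j ≢ k → δ j k ≡ 0#
  δ-≢ {j = j} {k} j≢k = cong (if_then 1# else 0#) (dec-false (j ≟ k) j≢k)

  -- Defs builds e k and f k by tabulating a where-bound, hence unnameable, function. Unifying a
  -- tail of neutral length p with tabulate h names it, and with-abstraction on the normal form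
  -- then exposes its case split on _≟_.
  e-tail : ∀ k → ∃ λ h → tail (e k) ≡ tabulate h
  e-tail k = _ , refl

  lookup-e : ∀ k j → lookup (e k) j ≡ δ j k
  lookup-e k zero with zero ≟ k
  ... | yes _ = refl
  ... | no _ = refl
  lookup-e k (suc j) rewrite lookup∘tabulate (proj₁ (e-tail k)) j with suc j ≟ k
  ... | yes _ = refl
  ... | no _ = refl

  f-tail : ∀ k → ∃ λ h → tail (tail (f k)) ≡ tabulate h
  f-tail k = _ , refl

  lookup-f : ∀ k j → lookup (f k) j ≡ δ j k
  lookup-f k zero with zero ≟ k
  ... | yes _ = refl
  ... | no _ = refl
  lookup-f k (suc zero) with suc zero ≟ k
  ... | yes _ = refl
  ... | no _ = refl
  lookup-f k (suc (suc j)) rewrite lookup∘tabulate (proj₁ (f-tail k)) j with suc (suc j) ≟ k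
  ... | yes _ = refl
  ... | no _ = refl

  multiplicity : ∀ {n} → Fin n → List (Fin n) → Zp
  multiplicity j = List.foldr (λ k m → δ j k + m) 0#

  lookup-sumE : ∀ ks j → lookup (sumE ks) j ≡ multiplicity j ks
  lookup-sumE [] j = lookup-replicate j 0#
  lookup-sumE (k ∷ ks) j =
    trans (lookup-zipWith _+_ j (e k) (sumE ks)) (cong₂ _+_ (lookup-e k j) (lookup-sumE ks j))

  lookup-sumF : ∀ ks j → lookup (sumF ks) j ≡ multiplicity j ks
  lookup-sumF [] j = lookup-replicate j 0#
  lookup-sumF (k ∷ ks) j =
    trans (lookup-zipWith _+_ j (f k) (sumF ks)) (cong₂ _+_ (lookup-f k j) (lookup-sumF ks j))

  sum-δ : ∀ {n} (j : Fin n) → sum (δ j) ≡ 1#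
  sum-δ {suc n} zero = trans (cong (1# +_) (sum-replicate-zero n)) (+-identityʳ 1#)
  sum-δ {suc n} (suc j) = trans (+-identityˡ (sum (δ j))) (sum-δ j)

  multiplicity-tabulate : ∀ {m n} (j : Fin n) (h : Fin m → Fin n) →
                          multiplicity j (List.tabulate h) ≡ sum (δ j ∘ h)
  multiplicity-tabulate {0} j h = refl
  multiplicity-tabulate {suc m} j h = cong (δ j (h zero) +_) (multiplicity-tabulate j (h ∘ suc))

  multiplicity-allFin : ∀ {n} (j : Fin n) → multiplicity j (allFin n) ≡ 1#
  multiplicity-allFin j = trans (multiplicity-tabulate j id) (sum-δ j)

  multiplicity-filter-self : ∀ {n} (i : Fin n) ks → multiplicity i (filter (λ k → ¬? (k ≟ i)) ks) ≡ 0#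
  multiplicity-filter-self i [] = refl
  multiplicity-filter-self i (k ∷ ks) with k ≟ i
  ... | yes refl = multiplicity-filter-self i ks
  ... | no k≢i = begin
    δ i k + multiplicity i (filter (λ k → ¬? (k ≟ i)) ks) ≡⟨ cong₂ _+_ (δ-≢ (k≢i ∘ sym)) (multiplicity-filter-self i ks) ⟩
    0# + 0#                                               ≡⟨ +-identityʳ 0# ⟩
    0# ∎
    where open ≡-Reasoning

  multiplicity-filter-≢ : ∀ {n} {i j : Fin n} → j ≢ i → ∀ ks →
                          multiplicity j (filter (λ k → ¬? (k ≟ i)) ks) ≡ multiplicity j ks
  multiplicity-filter-≢ j≢i [] = refl
  multiplicity-filter-≢ {i = i} {j} j≢i (k ∷ ks) with k ≟ i
  ... | yes refl = begin
    multiplicity j (filter (λ k → ¬? (k ≟ i)) ks) ≡⟨ multiplicity-filter-≢ j≢i ks ⟩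
    multiplicity j ks                             ≡⟨ +-identityˡ (multiplicity j ks) ⟨
    0# + multiplicity j ks                        ≡⟨ cong (_+ multiplicity j ks) (δ-≢ j≢i) ⟨
    δ j i + multiplicity j ks ∎
    where open ≡-Reasoning
  ... | no k≢i = cong (δ j k +_) (multiplicity-filter-≢ j≢i ks)

  lookup-eAll : ∀ j → lookup eAll j ≡ 1#
  lookup-eAll j = trans (lookup-sumE (allFin _) j) (multiplicity-allFin j)

  lookup-fAll : ∀ j → lookup fAll j ≡ 1#
  lookup-fAll j = trans (lookup-sumF (allFin _) j) (multiplicity-allFin j)

  lookup-others-self : ∀ i → lookup (sumE (others i)) i ≡ 0#
  lookup-others-self i = trans (lookup-sumE (others i) i) (multiplicity-filter-self i (allFin _))

  lookup-others-≢ : ∀ {i j} → j ≢ i → lookup (sumE (others i)) j ≡ 1#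
  lookup-others-≢ {i} {j} j≢i =
    trans (lookup-sumE (others i) j) (trans (multiplicity-filter-≢ j≢i (allFin _)) (multiplicity-allFin j))

  sum-*δ : ∀ {n} (t : Fin n → Zp) k → sum (λ j → t j * δ j k) ≡ t k
  sum-*δ {suc n} t zero = begin
    t zero * 1# + sum (λ j → t (suc j) * 0#) ≡⟨ cong₂ _+_ (*-identityʳ (t zero)) (sum-cong-≗ (zeroʳ ∘ t ∘ suc)) ⟩
    t zero + sum {n} (λ _ → 0#)              ≡⟨ cong (t zero +_) (sum-replicate-zero n) ⟩
    t zero + 0#                              ≡⟨ +-identityʳ (t zero) ⟩
    t zero ∎
    where open ≡-Reasoning
  sum-*δ {suc n} t (suc k) = begin
    t zero * 0# + sum (λ j → t (suc j) * δ j k) ≡⟨ cong (_+ sum (λ j → t (suc j) * δ j k)) (zeroʳ (t zero)) ⟩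
    0# + sum (λ j → t (suc j) * δ j k)          ≡⟨ +-identityˡ _ ⟩
    sum (λ j → t (suc j) * δ j k)               ≡⟨ sum-*δ (t ∘ suc) k ⟩
    t (suc k) ∎
    where open ≡-Reasoning

module InnerProduct (p : ℕ) .{{_ : NonZero p}} where
  open Construction p
  open ResidueRing p
  open UnitVectors p
  open CommutativeRing ℤₚ using (_+_; _*_; 0#; +-identityˡ; *-identityʳ; +-group)
  open Solver using (solve; _⊜_; _⊕_; _⊗_)
  open import Algebra.Properties.Group +-group using (//-rightDividesˡ; //-rightDividesʳ; ∙-cancelʳ)
  open ℤₚΣ using (sum; sum-cong-≗)

  infixl 7 _+ᵥ_ _-ᵥ_
  _+ᵥ_ _-ᵥ_ : ∀ {n} → Vec Zp n → Vec Zp n → Vec Zp n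
  _+ᵥ_ = zipWith _+_
  _-ᵥ_ = zipWith _-ₚ_

  infix 6.5 _·_
  _·_ : ∀ {n} → Vec Zp n → Vec Zp n → Zp
  x · y = foldr′ _+_ 0# (zipWith _*_ x y)

  ·-sum : ∀ {n} (x y : Vec Zp n) → x · y ≡ sum (λ j → lookup x j * lookup y j)
  ·-sum [] [] = refl
  ·-sum (a ∷ x) (b ∷ y) = cong (a * b +_) (·-sum x y)

  ·-distribʳ-+ : ∀ {n} (x y z : Vec Zp n) → x · (y +ᵥ z) ≡ x · y + x · z
  ·-distribʳ-+ [] [] [] = sym (+-identityˡ 0#)
  ·-distribʳ-+ (a ∷ x) (b ∷ y) (c ∷ z) =
    trans (cong (a * (b + c) +_) (·-distribʳ-+ x y z))
          (solve 5 (λ a b c s t → (a ⊗ (b ⊕ c) ⊕ (s ⊕ t)) ⊜ ((a ⊗ b ⊕ s) ⊕ (a ⊗ c ⊕ t))) refl a b c (x · y) (x · z))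

  ·-distribˡ-+ : ∀ {n} (x y z : Vec Zp n) → (x +ᵥ y) · z ≡ x · z + y · z
  ·-distribˡ-+ [] [] [] = sym (+-identityˡ 0#)
  ·-distribˡ-+ (a ∷ x) (b ∷ y) (c ∷ z) =
    trans (cong ((a + b) * c +_) (·-distribˡ-+ x y z))
          (solve 5 (λ a b c s t → ((a ⊕ b) ⊗ c ⊕ (s ⊕ t)) ⊜ ((a ⊗ c ⊕ s) ⊕ (b ⊗ c ⊕ t))) refl a b c (x · z) (y · z))

  ·-f : ∀ x k → x · f k ≡ lookup x k
  ·-f x k = trans (·-sum x (f k)) (trans (sum-cong-≗ (λ j → cong (lookup x j *_) (lookup-f k j))) (sum-*δ (lookup x) k))

  ·-fAll : ∀ x → x · fAll ≡ sum (lookup x)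
  ·-fAll x = trans (·-sum x fAll) (sum-cong-≗ (λ j → trans (cong (lookup x j *_) (lookup-fAll j)) (*-identityʳ (lookup x j))))

  x-ₚy+y≡x : ∀ a b → (a -ₚ b) + b ≡ a
  x-ₚy+y≡x a b = trans (cong (_+ b) (-ₚ≡+ₚnegₚ a b)) (//-rightDividesˡ b a)

  x+y-ₚy≡x : ∀ a b → (a + b) -ₚ b ≡ a
  x+y-ₚy≡x a b = trans (-ₚ≡+ₚnegₚ (a + b) b) (//-rightDividesʳ b a)

  x-ᵥy+ᵥy≡x : ∀ {n} (x y : Vec Zp n) → (x -ᵥ y) +ᵥ y ≡ x
  x-ᵥy+ᵥy≡x [] [] = refl
  x-ᵥy+ᵥy≡x (a ∷ x) (b ∷ y) = cong₂ _∷_ (x-ₚy+y≡x a b) (x-ᵥy+ᵥy≡x x y)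

  x+ᵥy-ᵥy≡x : ∀ {n} (x y : Vec Zp n) → (x +ᵥ y) -ᵥ y ≡ x
  x+ᵥy-ᵥy≡x [] [] = refl
  x+ᵥy-ᵥy≡x (a ∷ x) (b ∷ y) = cong₂ _∷_ (x+y-ₚy≡x a b) (x+ᵥy-ᵥy≡x x y)

  [x-ᵥz]·y+z·y≡x·y : ∀ {n} (x z y : Vec Zp n) → (x -ᵥ z) · y + z · y ≡ x · y
  [x-ᵥz]·y+z·y≡x·y x z y = trans (sym (·-distribˡ-+ (x -ᵥ z) z y)) (cong (_· y) (x-ᵥy+ᵥy≡x x z))

  ·-shift : ∀ {n} (v v′ g g′ y : Vec Zp n) t → g′ · y ≡ g · y + t →
            ((v′ +ᵥ g′) -ᵥ (v +ᵥ g)) · y ≡ (v′ -ᵥ v) · y + t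
  ·-shift v v′ g g′ y t g′y≡gy+t = ∙-cancelʳ (v · y + g · y) D′ (D + t) (begin
    D′ + (v · y + g · y)              ≡⟨ cong (D′ +_) (·-distribˡ-+ v g y) ⟨
    D′ + (v +ᵥ g) · y                 ≡⟨ [x-ᵥz]·y+z·y≡x·y (v′ +ᵥ g′) (v +ᵥ g) y ⟩
    (v′ +ᵥ g′) · y                    ≡⟨ ·-distribˡ-+ v′ g′ y ⟩
    v′ · y + g′ · y                   ≡⟨ cong₂ _+_ (sym ([x-ᵥz]·y+z·y≡x·y v′ v y)) g′y≡gy+t ⟩
    (D + v · y) + (g · y + t)         ≡⟨ solve 4 (λ d a b t → ((d ⊕ a) ⊕ (b ⊕ t)) ⊜ ((d ⊕ t) ⊕ (a ⊕ b))) refl D (v · y) (g · y) t ⟩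
    (D + t) + (v · y + g · y) ∎)
    where
    open ≡-Reasoning
    D D′ : Zp
    D = (v′ -ᵥ v) · y
    D′ = ((v′ +ᵥ g′) -ᵥ (v +ᵥ g)) · y

  ≡0#⇔+≡ : ∀ {a b t} → b ≡ a + t → (a ≡ 0# ⇔ b ≡ t)
  ≡0#⇔+≡ {a} {b} {t} b≡a+t = mk⇔
    (λ a≡0 → trans b≡a+t (trans (cong (_+ t) a≡0) (+-identityˡ t)))
    (λ b≡t → ∙-cancelʳ t a 0# (trans (sym b≡a+t) (trans b≡t (sym (+-identityˡ t)))))

module Digits (p : ℕ) .{{_ : NonZero p}} (1<p : 1 < p) where
  open import Data.Nat using (_+_; _*_; _/_; _%_)
  open Construction p using (Zp; U; _+ₚ_; 1ₚ)
  open ResidueRing p using ([_]; toℕ-[]; []-+; [m+k*p]≡[m]; [m+p]≡[m])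
  open MonoidSum ℕ.+-0-commutativeMonoid using (sum; sum-cong-≗; ∑-distrib-+; sum-remove)

  /-shift : ∀ a b c d → a + c * p ≡ b + d * p → a / p + c ≡ b / p + d
  /-shift a b c d eq = trans (sym (split a c)) (trans (cong (_/ p) eq) (split b d))
    where
    split : ∀ x k → (x + k * p) / p ≡ x / p + k
    split x k = trans (+-distrib-/-∣ʳ x (divides k refl)) (cong (x / p +_) (m*n/n≡m k p))

  carry : Zp → ℕ
  carry x = (toℕ x + 1) / p

  toℕ-+ₚ1ₚ : ∀ x → toℕ (x +ₚ 1ₚ) + carry x * p ≡ toℕ x + 1
  toℕ-+ₚ1ₚ x = begin
    toℕ [ toℕ x + toℕ 1ₚ ] + carry x * p   ≡⟨ cong (λ k → toℕ [ toℕ x + k ] + carry x * p) toℕ-1ₚ ⟩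
    toℕ [ toℕ x + 1 ] + carry x * p        ≡⟨ cong (_+ carry x * p) (toℕ-[] (toℕ x + 1)) ⟩
    (toℕ x + 1) % p + (toℕ x + 1) / p * p  ≡⟨ m≡m%n+[m/n]*n (toℕ x + 1) p ⟨
    toℕ x + 1 ∎
    where
    open ≡-Reasoning
    toℕ-1ₚ : toℕ 1ₚ ≡ 1
    toℕ-1ₚ = trans (toℕ-[] 1) (m<n⇒m%n≡m 1<p)

  digitSum carries : ∀ {m} → (Fin m → Zp) → ℕ
  digitSum t = sum (toℕ ∘ t)
  carries t = sum (carry ∘ t)

  digitSum-+ₚ1ₚ : ∀ {m} (t t′ : Fin m → Zp) → (∀ j → t′ j ≡ t j +ₚ 1ₚ) →
                  digitSum t′ + carries t * p ≡ digitSum t + m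
  digitSum-+ₚ1ₚ {0} t t′ t′≡t+1 = refl
  digitSum-+ₚ1ₚ {suc m} t t′ t′≡t+1 = begin
    (toℕ (t′ zero) + digitSum (t′ ∘ suc)) + (carry (t zero) + carries (t ∘ suc)) * p
      ≡⟨ interchange (toℕ (t′ zero)) (digitSum (t′ ∘ suc)) (carry (t zero)) (carries (t ∘ suc)) p ⟩
    (toℕ (t′ zero) + carry (t zero) * p) + (digitSum (t′ ∘ suc) + carries (t ∘ suc) * p)
      ≡⟨ cong₂ _+_ head-digit (digitSum-+ₚ1ₚ (t ∘ suc) (t′ ∘ suc) (t′≡t+1 ∘ suc)) ⟩
    (toℕ (t zero) + 1) + (digitSum (t ∘ suc) + m)
      ≡⟨ regroup (toℕ (t zero)) (digitSum (t ∘ suc)) m ⟩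
    (toℕ (t zero) + digitSum (t ∘ suc)) + suc m ∎
    where
    open ≡-Reasoning
    head-digit : toℕ (t′ zero) + carry (t zero) * p ≡ toℕ (t zero) + 1
    head-digit = trans (cong (λ y → toℕ y + carry (t zero) * p) (t′≡t+1 zero)) (toℕ-+ₚ1ₚ (t zero))
    interchange : ∀ a s c k n → (a + s) + (c + k) * n ≡ (a + c * n) + (s + k * n)
    interchange = solve-∀
    regroup : ∀ a s m → (a + 1) + (s + m) ≡ (a + s) + suc m
    regroup = solve-∀

  sum-const : ∀ n k → sum {n} (λ _ → k) ≡ n * k
  sum-const 0 k = refl
  sum-const (suc n) k = cong (k +_) (sum-const n k)

  wraps : ∀ {m} → (Fin m → Zp) → ℕ
  wraps t = digitSum t / p

  wrapsExcept carriesExcept : Fin (suc p) → U → ℕ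
  wrapsExcept i u = wraps (removeAt (lookup u) i)
  carriesExcept i u = carries (removeAt (lookup u) i)

  wrapsExceptSum : U → ℕ
  wrapsExceptSum u = sum (λ i → wrapsExcept i u)

  wrapsExcept-cong : ∀ i (u u′ : U) → (∀ k → lookup u′ (punchIn i k) ≡ lookup u (punchIn i k)) →
                     wrapsExcept i u′ ≡ wrapsExcept i u
  wrapsExcept-cong i u u′ u′≡u = cong (_/ p) (sum-cong-≗ (cong toℕ ∘ u′≡u))

  wrapsExcept-+ₚ1ₚ : ∀ i (u u′ : U) → (∀ k → lookup u′ (punchIn i k) ≡ lookup u (punchIn i k) +ₚ 1ₚ) →
                     wrapsExcept i u′ + carriesExcept i u ≡ wrapsExcept i u + 1
  wrapsExcept-+ₚ1ₚ i u u′ u′≡u+1 = /-shift _ _ _ 1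
    (trans (digitSum-+ₚ1ₚ (removeAt (lookup u) i) (removeAt (lookup u′) i) u′≡u+1)
           (cong (digitSum (removeAt (lookup u) i) +_) (sym (ℕ.*-identityˡ p))))

  wraps-+ₚ1ₚ-except : ∀ i (u u′ : U) → lookup u′ i ≡ lookup u i →
                      (∀ k → lookup u′ (punchIn i k) ≡ lookup u (punchIn i k) +ₚ 1ₚ) →
                      wraps (lookup u′) + carriesExcept i u ≡ wraps (lookup u) + 1
  wraps-+ₚ1ₚ-except i u u′ u′ᵢ≡uᵢ u′≡u+1 = /-shift _ _ _ 1 (begin
    digitSum (lookup u′) + C * p                 ≡⟨ cong (_+ C * p) (sum-remove (toℕ ∘ lookup u′)) ⟩
    toℕ (lookup u′ i) + rest u′ + C * p          ≡⟨ ℕ.+-assoc (toℕ (lookup u′ i)) (rest u′) (C * p) ⟩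
    toℕ (lookup u′ i) + (rest u′ + C * p)        ≡⟨ cong₂ _+_ (cong toℕ u′ᵢ≡uᵢ) (digitSum-+ₚ1ₚ _ _ u′≡u+1) ⟩
    toℕ (lookup u i) + (rest u + p)              ≡⟨ regroup (toℕ (lookup u i)) (rest u) p ⟩
    toℕ (lookup u i) + rest u + 1 * p            ≡⟨ cong (_+ 1 * p) (sum-remove (toℕ ∘ lookup u)) ⟨
    digitSum (lookup u) + 1 * p ∎)
    where
    open ≡-Reasoning
    C : ℕ
    C = carriesExcept i u
    rest : U → ℕ
    rest w = digitSum (removeAt (lookup w) i)
    regroup : ∀ a s n → a + (s + n) ≡ a + s + 1 * n
    regroup = solve-∀

  carriesExcept-sum : ∀ u → sum (λ i → carriesExcept i u) ≡ p * carries (lookup u)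
  carriesExcept-sum u = ℕ.+-cancelˡ-≡ K _ _ (begin
    K + sum (λ i → carriesExcept i u)                    ≡⟨ ∑-distrib-+ (carry ∘ lookup u) (λ i → carriesExcept i u) ⟨
    sum (λ i → carry (lookup u i) + carriesExcept i u)   ≡⟨ sum-cong-≗ (λ i → sum-remove {i = i} (carry ∘ lookup u)) ⟨
    sum {suc p} (λ _ → K)                               ≡⟨ sum-const (suc p) K ⟩
    K + p * K ∎)
    where
    open ≡-Reasoning
    K : ℕ
    K = carries (lookup u)

  wrapsExceptSum-carries : ∀ (u u′ : U) → (∀ j → lookup u′ j ≡ lookup u j +ₚ 1ₚ) →
                           wrapsExceptSum u′ + p * carries (lookup u) ≡ wrapsExceptSum u + suc p
  wrapsExceptSum-carries u u′ u′≡u+1 = begin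
    wrapsExceptSum u′ + p * carries (lookup u)              ≡⟨ cong (wrapsExceptSum u′ +_) (carriesExcept-sum u) ⟨
    wrapsExceptSum u′ + sum (λ i → carriesExcept i u)      ≡⟨ ∑-distrib-+ (λ i → wrapsExcept i u′) (λ i → carriesExcept i u) ⟨
    sum (λ i → wrapsExcept i u′ + carriesExcept i u)       ≡⟨ sum-cong-≗ (λ i → wrapsExcept-+ₚ1ₚ i u u′ (u′≡u+1 ∘ punchIn i)) ⟩
    sum (λ i → wrapsExcept i u + 1)                        ≡⟨ ∑-distrib-+ (λ i → wrapsExcept i u) (λ _ → 1) ⟩
    wrapsExceptSum u + sum {suc p} (λ _ → 1)               ≡⟨ cong (wrapsExceptSum u +_) (trans (sum-const (suc p) 1) (ℕ.*-identityʳ (suc p))) ⟩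
    wrapsExceptSum u + suc p ∎
    where open ≡-Reasoning

  wrapsExceptSum-+ₚ1ₚ : ∀ (u u′ : U) → (∀ j → lookup u′ j ≡ lookup u j +ₚ 1ₚ) →
                        [ wrapsExceptSum u′ ] ≡ [ wrapsExceptSum u ] +ₚ 1ₚ
  wrapsExceptSum-+ₚ1ₚ u u′ u′≡u+1 = begin
    [ Λ′ ]              ≡⟨ [m+k*p]≡[m] Λ′ K ⟨
    [ Λ′ + K * p ]      ≡⟨ cong (λ k → [ Λ′ + k ]) (ℕ.*-comm K p) ⟩
    [ Λ′ + p * K ]      ≡⟨ cong [_] (wrapsExceptSum-carries u u′ u′≡u+1) ⟩
    [ Λ + suc p ]       ≡⟨ cong [_] (ℕ.+-assoc Λ 1 p) ⟨
    [ Λ + 1 + p ]       ≡⟨ [m+p]≡[m] (Λ + 1) ⟩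
    [ Λ + 1 ]           ≡⟨ []-+ Λ 1 ⟩
    [ Λ ] +ₚ 1ₚ ∎
    where
    open ≡-Reasoning
    Λ Λ′ K : ℕ
    Λ = wrapsExceptSum u
    Λ′ = wrapsExceptSum u′
    K = carries (lookup u)

  wrapsExcept-balance : ∀ i (u u′ : U) → lookup u′ i ≡ lookup u i →
                        (∀ k → lookup u′ (punchIn i k) ≡ lookup u (punchIn i k) +ₚ 1ₚ) →
                        wrapsExcept i u′ + wraps (lookup u) ≡ wrapsExcept i u + wraps (lookup u′)
  wrapsExcept-balance i u u′ u′ᵢ≡uᵢ u′≡u+1 = ℕ.+-cancelʳ-≡ C _ _ (begin
    q′ + Q + C   ≡⟨ swap q′ Q C ⟩
    q′ + C + Q   ≡⟨ cong (_+ Q) (wrapsExcept-+ₚ1ₚ i u u′ u′≡u+1) ⟩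
    q + 1 + Q    ≡⟨ swap q 1 Q ⟩
    q + Q + 1    ≡⟨ ℕ.+-assoc q Q 1 ⟩
    q + (Q + 1)  ≡⟨ cong (q +_) (wraps-+ₚ1ₚ-except i u u′ u′ᵢ≡uᵢ u′≡u+1) ⟨
    q + (Q′ + C) ≡⟨ ℕ.+-assoc q Q′ C ⟨
    q + Q′ + C ∎)
    where
    open ≡-Reasoning
    q q′ Q Q′ C : ℕ
    q = wrapsExcept i u
    q′ = wrapsExcept i u′
    Q = wraps (lookup u)
    Q′ = wraps (lookup u′)
    C = carriesExcept i u
    swap : ∀ a b c → a + b + c ≡ a + c + b
    swap = solve-∀

module CayleyIsomorphism (p : ℕ) .{{_ : NonZero p}} (1<p : 1 < p) where
  open Construction p
  open ResidueRing p
  open UnitVectors p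
  open InnerProduct p
  open Digits p 1<p
  open CommutativeRing ℤₚ using (_+_; _*_; -_; _-_; 0#; 1#; +-assoc; +-comm; +-identityʳ; *-identityˡ; +-group)
  open import Algebra.Properties.Group +-group using (//-rightDividesˡ; ∙-cancelʳ)
  open ℤₚΣ using (sum; sum-cong-≗; ∑-distrib-+)

  offset : U → Zp
  offset u = [ wrapsExceptSum u ] + [ wraps (lookup u) ]

  shiftCoordinate : U → Fin (suc p) → Zp
  shiftCoordinate u i = [ wrapsExcept i u ] - offset u

  shiftVector : U → V
  shiftVector u = offset u ∷ tabulate (shiftCoordinate u)

  shiftVector-·A : ∀ u i → shiftVector u · (f zero +ᵥ f (suc i)) ≡ [ wrapsExcept i u ]
  shiftVector-·A u i = begin
    shiftVector u · (f zero +ᵥ f (suc i))                   ≡⟨ ·-distribʳ-+ (shiftVector u) (f zero) (f (suc i)) ⟩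
    shiftVector u · f zero + shiftVector u · f (suc i)      ≡⟨ cong₂ _+_ (·-f (shiftVector u) zero) (·-f (shiftVector u) (suc i)) ⟩
    offset u + lookup (tabulate (shiftCoordinate u)) i      ≡⟨ cong (offset u +_) (lookup∘tabulate (shiftCoordinate u) i) ⟩
    offset u + ([ wrapsExcept i u ] - offset u)             ≡⟨ +-comm (offset u) _ ⟩
    ([ wrapsExcept i u ] - offset u) + offset u             ≡⟨ //-rightDividesˡ (offset u) [ wrapsExcept i u ] ⟩
    [ wrapsExcept i u ] ∎
    where open ≡-Reasoning

  shiftVector-·fAll : ∀ u → shiftVector u · fAll ≡ [ wrapsExceptSum u ]
  shiftVector-·fAll u = begin
    shiftVector u · fAll                                    ≡⟨ ·-fAll (shiftVector u) ⟩
    offset u + sum (lookup (tabulate (shiftCoordinate u)))  ≡⟨ cong (offset u +_) (sum-cong-≗ (lookup∘tabulate (shiftCoordinate u))) ⟩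
    offset u + sum (shiftCoordinate u)                      ≡⟨ cong (offset u +_) (∑-distrib-+ (λ i → [ wrapsExcept i u ]) (λ _ → - offset u)) ⟩
    offset u + (sum (λ i → [ wrapsExcept i u ]) + sum {suc p} (λ _ → - offset u))
      ≡⟨ cong₂ (λ a b → offset u + (a + b)) ([]-sum (λ i → wrapsExcept i u)) (sym (sum-const-ℤₚ (suc p) (- offset u))) ⟨
    offset u + ([ wrapsExceptSum u ] + [ suc p ] * - offset u)
      ≡⟨ cong (λ k → offset u + ([ wrapsExceptSum u ] + k)) (trans (cong (_* - offset u) ([m+p]≡[m] 1)) (*-identityˡ (- offset u))) ⟩
    offset u + ([ wrapsExceptSum u ] - offset u)            ≡⟨ +-comm (offset u) _ ⟩
    ([ wrapsExceptSum u ] - offset u) + offset u            ≡⟨ //-rightDividesˡ (offset u) [ wrapsExceptSum u ] ⟩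
    [ wrapsExceptSum u ] ∎
    where open ≡-Reasoning

  shiftVector-·B : ∀ u i → shiftVector u · (f (suc i) +ᵥ fAll) + [ wraps (lookup u) ] ≡ [ wrapsExcept i u ]
  shiftVector-·B u i = begin
    shiftVector u · (f (suc i) +ᵥ fAll) + [ wraps (lookup u) ]
      ≡⟨ cong (_+ [ wraps (lookup u) ]) (·-distribʳ-+ (shiftVector u) (f (suc i)) fAll) ⟩
    (shiftVector u · f (suc i) + shiftVector u · fAll) + [ wraps (lookup u) ]
      ≡⟨ cong₂ (λ a b → (a + b) + [ wraps (lookup u) ]) (trans (·-f (shiftVector u) (suc i)) (lookup∘tabulate (shiftCoordinate u) i)) (shiftVector-·fAll u) ⟩
    (shiftCoordinate u i + [ wrapsExceptSum u ]) + [ wraps (lookup u) ]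
      ≡⟨ +-assoc (shiftCoordinate u i) [ wrapsExceptSum u ] [ wraps (lookup u) ] ⟩
    shiftCoordinate u i + offset u
      ≡⟨ //-rightDividesˡ (offset u) [ wrapsExcept i u ] ⟩
    [ wrapsExcept i u ] ∎
    where open ≡-Reasoning

  lookup-difference : ∀ (u u′ d : U) → u′ -ᵥ u ≡ d → ∀ j → lookup u′ j ≡ lookup u j + lookup d j
  lookup-difference u u′ d u′-u≡d j = begin
    lookup u′ j                              ≡⟨ x-ₚy+y≡x (lookup u′ j) (lookup u j) ⟨
    (lookup u′ j -ₚ lookup u j) + lookup u j ≡⟨ cong (_+ lookup u j) (trans (sym (lookup-zipWith _-ₚ_ j u′ u)) (cong (λ w → lookup w j) u′-u≡d)) ⟩
    lookup d j + lookup u j                  ≡⟨ +-comm (lookup d j) (lookup u j) ⟩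
    lookup u j + lookup d j ∎
    where open ≡-Reasoning

  shiftVector-eᵢ-step : ∀ i (u u′ : U) → u′ -ᵥ u ≡ e i →
                        shiftVector u′ · (f zero +ᵥ f (suc i)) ≡ shiftVector u · (f zero +ᵥ f (suc i)) + 0#
  shiftVector-eᵢ-step i u u′ u′-u≡eᵢ = begin
    shiftVector u′ · (f zero +ᵥ f (suc i))     ≡⟨ shiftVector-·A u′ i ⟩
    [ wrapsExcept i u′ ]                       ≡⟨ cong [_] (wrapsExcept-cong i u u′ unchanged) ⟩
    [ wrapsExcept i u ]                        ≡⟨ shiftVector-·A u i ⟨
    shiftVector u · (f zero +ᵥ f (suc i))      ≡⟨ +-identityʳ _ ⟨
    shiftVector u · (f zero +ᵥ f (suc i)) + 0# ∎
    where
    open ≡-Reasoning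
    unchanged : ∀ k → lookup u′ (punchIn i k) ≡ lookup u (punchIn i k)
    unchanged k = begin
      lookup u′ (punchIn i k)                                   ≡⟨ lookup-difference u u′ (e i) u′-u≡eᵢ (punchIn i k) ⟩
      lookup u (punchIn i k) + lookup (e i) (punchIn i k)       ≡⟨ cong (lookup u (punchIn i k) +_) (trans (lookup-e i (punchIn i k)) (δ-≢ (punchInᵢ≢i i k))) ⟩
      lookup u (punchIn i k) + 0#                               ≡⟨ +-identityʳ _ ⟩
      lookup u (punchIn i k) ∎

  shiftVector-othersᵢ-step : ∀ i (u u′ : U) → u′ -ᵥ u ≡ sumE (others i) →
                             shiftVector u′ · (f (suc i) +ᵥ fAll) ≡ shiftVector u · (f (suc i) +ᵥ fAll) + 0#
  shiftVector-othersᵢ-step i u u′ u′-u≡oᵢ = trans (∙-cancelʳ ([ Q′ ] + [ Q ]) Y′ Y (begin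
    Y′ + ([ Q′ ] + [ Q ])      ≡⟨ +-assoc Y′ [ Q′ ] [ Q ] ⟨
    Y′ + [ Q′ ] + [ Q ]        ≡⟨ cong (_+ [ Q ]) (shiftVector-·B u′ i) ⟩
    [ q′ ] + [ Q ]             ≡⟨ trans (sym ([]-+ q′ Q)) (trans (cong [_] (wrapsExcept-balance i u u′ uᵢ-unchanged others-+1)) ([]-+ q Q′)) ⟩
    [ q ] + [ Q′ ]             ≡⟨ cong (_+ [ Q′ ]) (shiftVector-·B u i) ⟨
    Y + [ Q ] + [ Q′ ]         ≡⟨ +-assoc Y [ Q ] [ Q′ ] ⟩
    Y + ([ Q ] + [ Q′ ])       ≡⟨ cong (Y +_) (+-comm [ Q ] [ Q′ ]) ⟩
    Y + ([ Q′ ] + [ Q ]) ∎)) (sym (+-identityʳ Y))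
    where
    open ≡-Reasoning
    Y Y′ : Zp
    Y = shiftVector u · (f (suc i) +ᵥ fAll)
    Y′ = shiftVector u′ · (f (suc i) +ᵥ fAll)
    q q′ Q Q′ : ℕ
    q = wrapsExcept i u
    q′ = wrapsExcept i u′
    Q = wraps (lookup u)
    Q′ = wraps (lookup u′)
    uᵢ-unchanged : lookup u′ i ≡ lookup u i
    uᵢ-unchanged = begin
      lookup u′ i                             ≡⟨ lookup-difference u u′ (sumE (others i)) u′-u≡oᵢ i ⟩
      lookup u i + lookup (sumE (others i)) i ≡⟨ cong (lookup u i +_) (lookup-others-self i) ⟩
      lookup u i + 0#                         ≡⟨ +-identityʳ _ ⟩
      lookup u i ∎
    others-+1 : ∀ k → lookup u′ (punchIn i k) ≡ lookup u (punchIn i k) + 1#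
    others-+1 k = trans (lookup-difference u u′ (sumE (others i)) u′-u≡oᵢ (punchIn i k))
                        (cong (lookup u (punchIn i k) +_) (lookup-others-≢ {i} {punchIn i k} (punchInᵢ≢i i k)))

  shiftVector-eAll-step : ∀ (u u′ : U) → u′ -ᵥ u ≡ eAll → shiftVector u′ · fAll ≡ shiftVector u · fAll + 1#
  shiftVector-eAll-step u u′ u′-u≡eAll = begin
    shiftVector u′ · fAll            ≡⟨ shiftVector-·fAll u′ ⟩
    [ wrapsExceptSum u′ ]            ≡⟨ wrapsExceptSum-+ₚ1ₚ u u′ all-+1 ⟩
    [ wrapsExceptSum u ] + 1#        ≡⟨ cong (_+ 1#) (shiftVector-·fAll u) ⟨
    shiftVector u · fAll + 1# ∎
    where
    open ≡-Reasoning
    all-+1 : ∀ j → lookup u′ j ≡ lookup u j + 1#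
    all-+1 j = trans (lookup-difference u u′ eAll u′-u≡eAll j) (cong (lookup u j +_) (lookup-eAll j))

  φ ψ : G → G
  φ (u , v) = u , v +ᵥ shiftVector u
  ψ (u , v) = u , v -ᵥ shiftVector u

  φ∘ψ : ∀ x → φ (ψ x) ≡ x
  φ∘ψ (u , v) = cong (u ,_) (x-ᵥy+ᵥy≡x v (shiftVector u))

  ψ∘φ : ∀ x → ψ (φ x) ≡ x
  ψ∘φ (u , v) = cong (u ,_) (x+ᵥy-ᵥy≡x v (shiftVector u))

  edges-correspond : ∀ a b → CayEdge S a b ⇔ CayEdge T (φ a) (φ b)
  edges-correspond (u , v) (u′ , v′) = Σ-⇔ (↠-id _) (λ {i} → edge-A i ⊎-⇔ edge-B i) ⊎-⇔ edge-C
    where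
    edge-A : ∀ i → A i ((u′ , v′) -G (u , v)) ⇔ A i (φ (u′ , v′) -G φ (u , v))
    edge-A i = Σ-⇔ (↠-id _) λ {u′-u≡eᵢ} → ≡0#⇔+≡ (·-shift v v′ (shiftVector u) (shiftVector u′) _ 0# (shiftVector-eᵢ-step i u u′ u′-u≡eᵢ))
    edge-B : ∀ i → B i ((u′ , v′) -G (u , v)) ⇔ B i (φ (u′ , v′) -G φ (u , v))
    edge-B i = Σ-⇔ (↠-id _) λ {u′-u≡oᵢ} → ≡0#⇔+≡ (·-shift v v′ (shiftVector u) (shiftVector u′) _ 0# (shiftVector-othersᵢ-step i u u′ u′-u≡oᵢ))
    edge-C : C₀ ((u′ , v′) -G (u , v)) ⇔ C₁ (φ (u′ , v′) -G φ (u , v))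
    edge-C = Σ-⇔ (↠-id _) λ {u′-u≡eAll} → ≡0#⇔+≡ (·-shift v v′ (shiftVector u) (shiftVector u′) _ 1# (shiftVector-eAll-step u u′ u′-u≡eAll))

  cayIso : CayIso S T
  cayIso = ↔⇒⤖ (mk↔ₛ′ φ ψ φ∘ψ ψ∘φ) , edges-correspond

proposition1 : (p : ℕ) .{{nz : NonZero p}} → Prime p → 2 < p →
    Construction.CayIso p (Construction.S p) (Construction.T p)
proposition1 p _ 2<p = CayleyIsomorphism.cayIso p (ℕ.<⇒≤ 2<p)
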